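{- Let $n\ge2$, let $\pi$ be a bijection of $\mathbb Z$ with $\pi(i+n)=\pi(i)+n$ for all $i$, and let $\tau\in T\cup L$. Then $\tau\pi$ has at most one more mod-$n$ class of finite cycles than $\pi$ has.
   Context: For a periodic permutation $\pi$ (i.e. $\pi(i+n)=\pi(i)+n$), if $(a_1\ \cdots\ a_k)$ is a finite cycle of $\pi$ (fixed points count as cycles of length one), then so is $(a_1+\ell n\ \cdots\ a_k+\ell n)$ for all $\ell\in\mathbb Z$; the set of these translates is a mod-$n$ class of finite cycles, written $(a_1\ \cdots\ a_k)_n$. $T=\{(i\ \ j)_n:i\not\equiv j\bmod n\}$ is the set of reflections. For $i=1,\ldots,n$, $\ell_i$ is the permutation sending $i+kn\mapsto i+(k+1)n$ for all $k$ and fixing integers not congruent to $i$ mod $n$; $L=\{\ell_i,\ell_i^{ -1}:1\le i\le n\}$. -}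

module Defs where

open import Data.Nat using (ℕ; zero; suc; NonZero; _≤_)
open import Data.Nat as ℕ using ()
open import Data.Integer using (ℤ; +_; _+_; _-_; _*_)
open import Data.Integer.DivMod using (_%ℕ_)
open import Data.Fin using (Fin)
open import Data.Product using (Σ; ∃; _×_; _,_)
open import Data.Sum using (_⊎_)
open import Relation.Binary.PropositionalEquality using (_≡_)
open import Relation.Nullary using (¬_; yes; no)
open import Function.Definitions using (Bijective)

iter : (ℤ → ℤ) → ℕ → ℤ → ℤ
iter f zero    x = x
iter f (suc k) x = f (iter f k x)

PeriodicPerm : ℕ → (ℤ → ℤ) → Set
PeriodicPerm n π = Bijective _≡_ _≡_ π × (∀ i → π (i + + n) ≡ π i + + n)

OnFiniteCycle : (ℤ → ℤ) → ℤ → Set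
OnFiniteCycle σ a = ∃ λ k → iter σ (suc k) a ≡ a

-- the cycle of σ through a and the cycle through b are in the same mod-n
-- class, i.e. some translate b + ℓn of b lies on the cycle through a
SameClass : ℕ → (ℤ → ℤ) → ℤ → ℤ → Set
SameClass n σ a b = Σ ℕ λ k → Σ ℤ λ ℓ → iter σ k a ≡ b + ℓ * + n

AtLeastClasses : ℕ → (ℤ → ℤ) → ℕ → Set
AtLeastClasses n σ m =
  Σ (Fin m → ℤ) λ a →
    (∀ p → OnFiniteCycle σ (a p)) ×
    (∀ p q → SameClass n σ (a p) (a q) → p ≡ q)

-- the reflection (i j)_n : swaps i + kn ↔ j + kn for all k
refl-perm : (n : ℕ) → .{{NonZero n}} → ℤ → ℤ → ℤ → ℤ
refl-perm n i j x with x %ℕ n ℕ.≟ i %ℕ n | x %ℕ n ℕ.≟ j %ℕ n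
... | yes _ | _     = x + (j - i)
... | no _  | yes _ = x + (i - j)
... | no _  | no _  = x

-- ℓ_i : i + kn ↦ i + (k+1)n, fixing other residues
shift : (n : ℕ) → .{{NonZero n}} → ℕ → ℤ → ℤ
shift n i x with x %ℕ n ℕ.≟ i ℕ.% n
... | yes _ = x + + n
... | no _  = x

unshift : (n : ℕ) → .{{NonZero n}} → ℕ → ℤ → ℤ
unshift n i x with x %ℕ n ℕ.≟ i ℕ.% n
... | yes _ = x - + n
... | no _  = x

-- τ ∈ T ∪ L (as maps ℤ → ℤ, up to pointwise equality)
InTL : (n : ℕ) → .{{NonZero n}} → (ℤ → ℤ) → Set
InTL n τ =
  (Σ ℤ λ i → Σ ℤ λ j → ¬ (i %ℕ n ≡ j %ℕ n) × (∀ x → τ x ≡ refl-perm n i j x))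
  ⊎ (Σ ℕ λ i → 1 ≤ i × i ≤ n ×
       ((∀ x → τ x ≡ shift n i x) ⊎ (∀ x → τ x ≡ unshift n i x)))

{-# OPTIONS --safe #-}
-- Write σ = τπ. The map τ moves only the residue classes in a set R (one class for ℓᵢ^±1,
-- two for a reflection) and maps R into itself, so along any stretch of a σ-orbit that stays
-- outside R the maps σ and π agree: a σ-class avoiding R is a π-class, and distinct such
-- classes stay distinct. A periodic map has at most one mod-n class of finite cycles meeting a
-- given residue, since translates of cycles are cycles. If at most one σ-class meets R, dropping
-- it leaves m π-classes. Otherwise τ = (i j)ₙ and distinct σ-classes meet i and j. From a point
-- x ≡ i of the first, π agrees with σ until the orbit returns to R; that return is in the
-- class of i (the other σ-class owns j), hence at x itself, as a finite cycle meets the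
-- translates x + ℓn only at x. So π reaches τx; likewise π leads from τx ≡ j back to
-- ττx = x. Hence x lies on a finite π-cycle, which stands in for both merged σ-classes.
module Submission where

open import Defs
open import Data.Nat as ℕ using (ℕ; NonZero; zero; suc; _≤_; _<_)
import Data.Nat.Properties as ℕₚ
open import Data.Nat.DivMod using (m≡m%n+[m/n]*n; m%n<n)
open import Data.Nat.Induction using (<-rec)
open import Data.Integer using (ℤ; +_; +[1+_]; -[1+_]; _+_; _-_; _*_; -_; 0ℤ; 1ℤ)
open import Data.Integer.Properties
  using (+-injective; pos-+; pos-*; +-identityʳ; *-identityˡ; *-zeroʳ; *-cancelˡ-≡; *-cancelʳ-≡)
open import Data.Integer.DivMod using (_%ℕ_; _/ℕ_; a≡a%ℕn+[a/ℕn]*n; n%ℕd<d)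
open import Data.Integer.Tactic.RingSolver using (solve-∀)
open import Data.Fin as Fin using (Fin; punchIn)
open import Data.Fin.Properties as Finₚ using (any?; punchInᵢ≢i; punchIn-injective)
open import Data.Empty using (⊥-elim)
open import Data.Product using (∃; _×_; _,_)
open import Data.Sum using (_⊎_; inj₁; inj₂; [_,_]′)
open import Function using (_∘_)
open import Relation.Binary.PropositionalEquality
open import Relation.Nullary using (¬_; Dec; yes; no; ¬?)
open import Relation.Nullary.Decidable using (map′; decidable-stable; _×-dec_; _⊎-dec_)

iter-+ : ∀ (f : ℤ → ℤ) j k x → iter f (j ℕ.+ k) x ≡ iter f j (iter f k x)
iter-+ f zero    k x = refl
iter-+ f (suc j) k x = cong f (iter-+ f j k x)

iter-commute : ∀ {f g : ℤ → ℤ} → (∀ x → f (g x) ≡ g (f x)) →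
               ∀ k x → iter f k (g x) ≡ g (iter f k x)
iter-commute         comm zero    x = refl
iter-commute {f} {g} comm (suc k) x = trans (cong f (iter-commute comm k x)) (comm (iter f k x))

iter-agree : ∀ {f g : ℤ → ℤ} {x} k → (∀ s → s < k → f (iter g s x) ≡ g (iter g s x)) →
             iter f k x ≡ iter g k x
iter-agree     zero    agree = refl
iter-agree {f} (suc k) agree =
  trans (cong f (iter-agree k (λ s s<k → agree s (ℕₚ.m<n⇒m<1+n s<k)))) (agree k ℕₚ.≤-refl)

iter-cong : ∀ {f g : ℤ → ℤ} → (∀ x → f x ≡ g x) → ∀ k {x} → iter f k x ≡ iter g k x
iter-cong f≗g k = iter-agree k (λ s _ → f≗g _)

module _ {f : ℤ → ℤ} {a : ℤ} {p : ℕ} (cycle : iter f (suc p) a ≡ a) where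

  iter-*-period : ∀ q → iter f (q ℕ.* suc p) a ≡ a
  iter-*-period zero    = refl
  iter-*-period (suc q) =
    trans (iter-+ f (suc p) (q ℕ.* suc p) a) (trans (cong (iter f (suc p)) (iter-*-period q)) cycle)

  iter-%-period : ∀ k → iter f k a ≡ iter f (k ℕ.% suc p) a
  iter-%-period k = begin
    iter f k a                                                      ≡⟨ cong (λ j → iter f j a) (m≡m%n+[m/n]*n k (suc p)) ⟩
    iter f (k ℕ.% suc p ℕ.+ (k ℕ./ suc p) ℕ.* suc p) a               ≡⟨ iter-+ f (k ℕ.% suc p) _ a ⟩
    iter f (k ℕ.% suc p) (iter f ((k ℕ./ suc p) ℕ.* suc p) a)        ≡⟨ cong (iter f (k ℕ.% suc p)) (iter-*-period (k ℕ./ suc p)) ⟩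
    iter f (k ℕ.% suc p) a                                          ∎
    where open ≡-Reasoning

onFiniteCycle-iter : ∀ {f a} k → OnFiniteCycle f a → OnFiniteCycle f (iter f k a)
onFiniteCycle-iter {f} {a} k (p , cycle) = p , (begin
  iter f (suc p) (iter f k a)  ≡⟨ sym (iter-+ f (suc p) k a) ⟩
  iter f (suc p ℕ.+ k) a       ≡⟨ cong (λ j → iter f j a) (ℕₚ.+-comm (suc p) k) ⟩
  iter f (k ℕ.+ suc p) a       ≡⟨ iter-+ f k (suc p) a ⟩
  iter f k (iter f (suc p) a)  ≡⟨ cong (iter f k) cycle ⟩
  iter f k a                   ∎)
  where open ≡-Reasoning

onFiniteCycle-return : ∀ {f a} → OnFiniteCycle f a → ∀ k → ∃ λ c → iter f c (iter f k a) ≡ a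
onFiniteCycle-return {f} {a} (p , cycle) k = k ℕ.* p , (begin
  iter f (k ℕ.* p) (iter f k a)  ≡⟨ sym (iter-+ f (k ℕ.* p) k a) ⟩
  iter f (k ℕ.* p ℕ.+ k) a       ≡⟨ cong (λ j → iter f j a) (trans (ℕₚ.+-comm (k ℕ.* p) k) (sym (ℕₚ.*-suc k p))) ⟩
  iter f (k ℕ.* suc p) a         ≡⟨ iter-*-period cycle k ⟩
  a                              ∎)
  where open ≡-Reasoning

orbit-any? : ∀ {f a} {P : ℤ → Set} → (∀ x → Dec (P x)) → OnFiniteCycle f a →
             Dec (∃ λ k → P (iter f k a))
orbit-any? {f} {a} {P} P? (p , cycle) =
  map′ (λ (k , _ , Pk) → k , Pk)
       (λ (k , Pk) → k ℕ.% suc p , m%n<n k (suc p) , subst P (iter-%-period cycle k) Pk)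
       (ℕₚ.anyUpTo? (λ k → P? (iter f k a)) (suc p))

minimal-witness : ∀ {P : ℕ → Set} → (∀ k → Dec (P k)) → ∀ {v} → P v →
                  ∃ λ t → P t × (∀ s → s < t → ¬ P s)
minimal-witness {P} P? {v} = <-rec (λ v → P v → ∃ λ t → P t × (∀ s → s < t → ¬ P s)) step v
  where
  step : ∀ v → (∀ {s} → s < v → P s → ∃ λ t → P t × (∀ s → s < t → ¬ P s)) →
         P v → ∃ λ t → P t × (∀ s → s < t → ¬ P s)
  step v smaller Pv with ℕₚ.anyUpTo? P? v
  ... | yes (s , s<v , Ps) = smaller s<v Ps
  ... | no none            = v , Pv , λ s s<v Ps → none (s , s<v , Ps)

module _ (n : ℕ) .{{_ : NonZero n}} where

  private
    a≡b+c*d⇒b≡a+[-c]*d : ∀ a b c d → a ≡ b + c * d → b ≡ a + (- c) * d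
    a≡b+c*d⇒b≡a+[-c]*d a b c d eq = trans (cancel b c d) (cong (_+ (- c) * d) (sym eq))
      where cancel : ∀ b c d → b ≡ (b + c * d) + (- c) * d
            cancel = solve-∀

    n≤r : ∀ {r s} k → + r ≡ + s + + suc k * + n → n ℕ.≤ r
    n≤r {r} {s} k eq = subst (n ℕ.≤_) (sym r≡s+[1+k]n) (ℕₚ.≤-trans (ℕₚ.m≤m+n n (k ℕ.* n)) (ℕₚ.m≤n+m _ s))
      where r≡s+[1+k]n : r ≡ s ℕ.+ suc k ℕ.* n
            r≡s+[1+k]n = +-injective (trans eq (trans (cong (_+_ (+ s)) (sym (pos-* (suc k) n))) (sym (pos-+ s _))))

  remainder-unique : ∀ {r s} k → r < n → s < n → + r ≡ + s + k * + n → r ≡ s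
  remainder-unique {s = s} (+ zero) _ _ eq = +-injective (trans eq (+-identityʳ (+ s)))
  remainder-unique +[1+ k ] r<n _   eq = ⊥-elim (ℕₚ.<⇒≱ r<n (n≤r k eq))
  remainder-unique -[1+ k ] _   s<n eq = ⊥-elim (ℕₚ.<⇒≱ s<n (n≤r k (a≡b+c*d⇒b≡a+[-c]*d _ _ -[1+ k ] (+ n) eq)))

  [r+qn]%ℕn≡r : ∀ {r} q → r < n → (+ r + q * + n) %ℕ n ≡ r
  [r+qn]%ℕn≡r {r} q r<n = remainder-unique (q - x /ℕ n) (n%ℕd<d x n) r<n (begin
    + (x %ℕ n)                ≡⟨ a≡b+c*d⇒b≡a+[-c]*d x _ (x /ℕ n) (+ n) (a≡a%ℕn+[a/ℕn]*n x n) ⟩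
    x + (- (x /ℕ n)) * + n    ≡⟨ collect (+ r) q (x /ℕ n) (+ n) ⟩
    + r + (q - x /ℕ n) * + n  ∎)
    where
    open ≡-Reasoning
    x = + r + q * + n
    collect : ∀ a q d m → (a + q * m) + (- d) * m ≡ a + (q - d) * m
    collect = solve-∀

  [x+ℓn]%ℕn≡x%ℕn : ∀ x ℓ → (x + ℓ * + n) %ℕ n ≡ x %ℕ n
  [x+ℓn]%ℕn≡x%ℕn x ℓ = trans (cong (_%ℕ n) x+ℓn≡) ([r+qn]%ℕn≡r (x /ℕ n + ℓ) (n%ℕd<d x n))
    where
    collect : ∀ r q ℓ m → (r + q * m) + ℓ * m ≡ r + (q + ℓ) * m
    collect = solve-∀
    x+ℓn≡ : x + ℓ * + n ≡ + (x %ℕ n) + (x /ℕ n + ℓ) * + n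
    x+ℓn≡ = trans (cong (_+ ℓ * + n) (a≡a%ℕn+[a/ℕn]*n x n)) (collect (+ (x %ℕ n)) (x /ℕ n) ℓ (+ n))

  [x+n]%ℕn≡x%ℕn : ∀ x → (x + + n) %ℕ n ≡ x %ℕ n
  [x+n]%ℕn≡x%ℕn x = trans (cong (λ d → (x + d) %ℕ n) (sym (*-identityˡ (+ n)))) ([x+ℓn]%ℕn≡x%ℕn x 1ℤ)

  %ℕ-≡⇒translate : ∀ x y → x %ℕ n ≡ y %ℕ n → ∃ λ ℓ → x ≡ y + ℓ * + n
  %ℕ-≡⇒translate x y same = x /ℕ n - y /ℕ n , (begin
    x                                                    ≡⟨ a≡a%ℕn+[a/ℕn]*n x n ⟩
    + (x %ℕ n) + x /ℕ n * + n                            ≡⟨ cong (λ r → + r + x /ℕ n * + n) same ⟩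
    + (y %ℕ n) + x /ℕ n * + n                            ≡⟨ regroup (+ (y %ℕ n)) (x /ℕ n) (y /ℕ n) (+ n) ⟩
    (+ (y %ℕ n) + y /ℕ n * + n) + (x /ℕ n - y /ℕ n) * + n ≡⟨ cong (_+ (x /ℕ n - y /ℕ n) * + n) (sym (a≡a%ℕn+[a/ℕn]*n y n)) ⟩
    y + (x /ℕ n - y /ℕ n) * + n                          ∎)
    where
    open ≡-Reasoning
    regroup : ∀ r p q m → r + p * m ≡ (r + q * m) + (p - q) * m
    regroup = solve-∀

  %ℕ-+-difference : ∀ x i j → x %ℕ n ≡ i %ℕ n → (x + (j - i)) %ℕ n ≡ j %ℕ n
  %ℕ-+-difference x i j same with %ℕ-≡⇒translate x i same
  ... | ℓ , x≡i+ℓn = trans (cong (_%ℕ n) (trans (cong (_+ (j - i)) x≡i+ℓn) (move i j ℓ (+ n))))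
                           ([x+ℓn]%ℕn≡x%ℕn j ℓ)
    where move : ∀ i j ℓ m → (i + ℓ * m) + (j - i) ≡ j + ℓ * m
          move = solve-∀

  Periodic : (ℤ → ℤ) → Set
  Periodic σ = ∀ x → σ (x + + n) ≡ σ x + + n

  AtLeastClasses-cong : ∀ {f g m} → (∀ x → f x ≡ g x) → AtLeastClasses n f m → AtLeastClasses n g m
  AtLeastClasses-cong f≗g (a , cycles , distinct) =
    a ,
    (λ p → let (k , cycle) = cycles p in k , trans (sym (iter-cong f≗g (suc k))) cycle) ,
    (λ p q (k , ℓ , eq) → distinct p q (k , ℓ , trans (iter-cong f≗g k) eq))

  AtLeastClasses-drop : ∀ {f m} (b : Fin (suc m) → ℤ) d →
    (∀ p → p ≢ d → OnFiniteCycle f (b p)) →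
    (∀ p q → p ≢ d → q ≢ d → SameClass n f (b p) (b q) → p ≡ q) →
    AtLeastClasses n f m
  AtLeastClasses-drop b d cycles distinct =
    b ∘ punchIn d ,
    (λ p → cycles _ (punchInᵢ≢i d p)) ,
    (λ p q same → punchIn-injective d p q (distinct _ _ (punchInᵢ≢i d p) (punchInᵢ≢i d q) same))

  module PeriodicMap {σ : ℤ → ℤ} (σ-periodic : Periodic σ) where

    periodic-+ℕ* : ∀ k x → σ (x + + k * + n) ≡ σ x + + k * + n
    periodic-+ℕ* zero    x = trans (cong σ (+-identityʳ x)) (sym (+-identityʳ (σ x)))
    periodic-+ℕ* (suc k) x = begin
      σ (x + + suc k * + n)      ≡⟨ cong σ (step x (+ k) (+ n)) ⟩
      σ ((x + + k * + n) + + n)  ≡⟨ σ-periodic _ ⟩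
      σ (x + + k * + n) + + n    ≡⟨ cong (_+ + n) (periodic-+ℕ* k x) ⟩
      (σ x + + k * + n) + + n    ≡⟨ sym (step (σ x) (+ k) (+ n)) ⟩
      σ x + + suc k * + n        ∎
      where
      open ≡-Reasoning
      step : ∀ x k m → x + (+ 1 + k) * m ≡ (x + k * m) + m
      step = solve-∀

    periodic-+ℤ* : ∀ ℓ x → σ (x + ℓ * + n) ≡ σ x + ℓ * + n
    periodic-+ℤ* (+ k)    x = periodic-+ℕ* k x
    periodic-+ℤ* -[1+ k ] x = begin
      σ y                      ≡⟨ cancel (σ y) m ⟩
      (σ y + m) - m            ≡⟨ cong (_- m) (sym (periodic-+ℕ* (suc k) y)) ⟩
      σ (y + m) - m            ≡⟨ cong (λ z → σ z - m) (uncancel x (+ suc k) (+ n)) ⟩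
      σ x - m                  ≡⟨ negate (σ x) (+ suc k) (+ n) ⟩
      σ x + -[1+ k ] * + n     ∎
      where
      open ≡-Reasoning
      m = + suc k * + n
      y = x + -[1+ k ] * + n
      cancel : ∀ a m → a ≡ (a + m) - m
      cancel = solve-∀
      uncancel : ∀ x c m → (x + (- c) * m) + c * m ≡ x
      uncancel = solve-∀
      negate : ∀ a c m → a - c * m ≡ a + (- c) * m
      negate = solve-∀

    iter-periodic-+ℤ* : ∀ k ℓ x → iter σ k (x + ℓ * + n) ≡ iter σ k x + ℓ * + n
    iter-periodic-+ℤ* k ℓ = iter-commute (periodic-+ℤ* ℓ) k

    iter-%ℕ-cong : ∀ k {x y} → x %ℕ n ≡ y %ℕ n → iter σ k x %ℕ n ≡ iter σ k y %ℕ n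
    iter-%ℕ-cong k {x} {y} same with %ℕ-≡⇒translate x y same
    ... | ℓ , refl = trans (cong (_%ℕ n) (iter-periodic-+ℤ* k ℓ y)) ([x+ℓn]%ℕn≡x%ℕn (iter σ k y) ℓ)

    onFiniteCycle-%ℕ-cong : ∀ {x y} → x %ℕ n ≡ y %ℕ n → OnFiniteCycle σ y → OnFiniteCycle σ x
    onFiniteCycle-%ℕ-cong {x} {y} same (p , cycle) with %ℕ-≡⇒translate x y same
    ... | ℓ , refl = p , trans (iter-periodic-+ℤ* (suc p) ℓ y) (cong (_+ ℓ * + n) cycle)

    sameClass-of-%ℕ : ∀ {a b} k k' → OnFiniteCycle σ b →
                      iter σ k a %ℕ n ≡ iter σ k' b %ℕ n → SameClass n σ a b
    sameClass-of-%ℕ {a} {b} k k' b-cycle same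
      with %ℕ-≡⇒translate (iter σ k a) (iter σ k' b) same | onFiniteCycle-return b-cycle k'
    ... | ℓ , eq | c , back = c ℕ.+ k , ℓ , (begin
      iter σ (c ℕ.+ k) a                 ≡⟨ iter-+ σ c k a ⟩
      iter σ c (iter σ k a)              ≡⟨ cong (iter σ c) eq ⟩
      iter σ c (iter σ k' b + ℓ * + n)   ≡⟨ iter-periodic-+ℤ* c ℓ _ ⟩
      iter σ c (iter σ k' b) + ℓ * + n   ≡⟨ cong (_+ ℓ * + n) back ⟩
      b + ℓ * + n                        ∎)
      where open ≡-Reasoning

    SameClass-sym : ∀ {a b} → OnFiniteCycle σ a → SameClass n σ a b → SameClass n σ b a
    SameClass-sym {b = b} a-cycle (k , ℓ , eq) =
      sameClass-of-%ℕ 0 k a-cycle (sym (trans (cong (_%ℕ n) eq) ([x+ℓn]%ℕn≡x%ℕn b ℓ)))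

    onFiniteCycle-%ℕ-injective : ∀ {z} t → OnFiniteCycle σ z → iter σ t z %ℕ n ≡ z %ℕ n → iter σ t z ≡ z
    onFiniteCycle-%ℕ-injective {z} t (p , cycle) same with %ℕ-≡⇒translate (iter σ t z) z same
    ... | ℓ , σᵗz≡z+ℓn = trans σᵗz≡z+ℓn (trans (cong (λ ℓ → z + ℓ * + n) ℓ≡0) (+-identityʳ z))
      where
      open ≡-Reasoning
      iter-*-translate : ∀ s → iter σ (s ℕ.* t) z ≡ z + (+ s * ℓ) * + n
      iter-*-translate zero    = sym (+-identityʳ z)
      iter-*-translate (suc s) = begin
        iter σ (t ℕ.+ s ℕ.* t) z             ≡⟨ iter-+ σ t (s ℕ.* t) z ⟩
        iter σ t (iter σ (s ℕ.* t) z)        ≡⟨ cong (iter σ t) (iter-*-translate s) ⟩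
        iter σ t (z + (+ s * ℓ) * + n)       ≡⟨ iter-periodic-+ℤ* t (+ s * ℓ) z ⟩
        iter σ t z + (+ s * ℓ) * + n         ≡⟨ cong (_+ (+ s * ℓ) * + n) σᵗz≡z+ℓn ⟩
        (z + ℓ * + n) + (+ s * ℓ) * + n      ≡⟨ collect z (+ s) ℓ (+ n) ⟩
        z + (+ suc s * ℓ) * + n              ∎
        where collect : ∀ z s ℓ m → (z + ℓ * m) + (s * ℓ) * m ≡ z + ((+ 1 + s) * ℓ) * m
              collect = solve-∀
      periodℓn≡0 : (+ suc p * ℓ) * + n ≡ 0ℤ
      periodℓn≡0 = begin
        (+ suc p * ℓ) * + n                          ≡⟨ isolate z ((+ suc p * ℓ) * + n) ⟩
        (z + (+ suc p * ℓ) * + n) - z                ≡⟨ cong (_- z) (sym (iter-*-translate (suc p))) ⟩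
        iter σ (suc p ℕ.* t) z - z                   ≡⟨ cong (λ k → iter σ k z - z) (ℕₚ.*-comm (suc p) t) ⟩
        iter σ (t ℕ.* suc p) z - z                   ≡⟨ cong (_- z) (iter-*-period cycle t) ⟩
        z - z                                        ≡⟨ vanish z ⟩
        0ℤ                                           ∎
        where isolate : ∀ z d → d ≡ (z + d) - z
              isolate = solve-∀
              vanish : ∀ z → z - z ≡ 0ℤ
              vanish = solve-∀
      ℓ≡0 : ℓ ≡ 0ℤ
      ℓ≡0 = *-cancelˡ-≡ (+ suc p) ℓ 0ℤ
              (trans (*-cancelʳ-≡ (+ suc p * ℓ) 0ℤ (+ n) periodℓn≡0) (sym (*-zeroʳ (+ suc p))))

  module Reduction {π τ : ℤ → ℤ} (π-periodic : Periodic π) (τ-periodic : Periodic τ)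
                   {R : ℕ → Set} (R? : ∀ r → Dec (R r))
                   (τ-fixes : ∀ x → ¬ R (x %ℕ n) → τ x ≡ x)
                   (τ-preserves : ∀ x → R (x %ℕ n) → R (τ x %ℕ n)) where

    σ : ℤ → ℤ
    σ = τ ∘ π

    σ-periodic : Periodic σ
    σ-periodic x = trans (cong τ (π-periodic x)) (τ-periodic (π x))

    open PeriodicMap {σ} σ-periodic public

    Avoids : ℤ → Set
    Avoids a = ∀ k → ¬ R (iter σ k a %ℕ n)

    MeetsROnlyInResidueOf : ℤ → Set
    MeetsROnlyInResidueOf z = ∀ s → R (iter σ s z %ℕ n) → iter σ s z %ℕ n ≡ z %ℕ n

    π≡σ-outside-R : ∀ w → ¬ R (σ w %ℕ n) → π w ≡ σ w
    π≡σ-outside-R w σw∉R = sym (τ-fixes (π w) (σw∉R ∘ τ-preserves (π w)))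

    iter-π≡iter-σ : ∀ {a} k → (∀ s → s < k → ¬ R (iter σ (suc s) a %ℕ n)) → iter π k a ≡ iter σ k a
    iter-π≡iter-σ k outside = iter-agree k (λ s s<k → π≡σ-outside-R _ (outside s s<k))

    avoids-iter : ∀ {a} → Avoids a → ∀ k → iter π k a ≡ iter σ k a
    avoids-iter avoids k = iter-π≡iter-σ k (λ s _ → avoids (suc s))

    avoids-onFiniteCycle : ∀ {a} → Avoids a → OnFiniteCycle σ a → OnFiniteCycle π a
    avoids-onFiniteCycle avoids (p , cycle) = p , trans (avoids-iter avoids (suc p)) cycle

    avoids-sameClass : ∀ {a b} → Avoids a → SameClass n π a b → SameClass n σ a b
    avoids-sameClass avoids (k , ℓ , eq) = k , ℓ , trans (sym (avoids-iter avoids k)) eq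

    avoids-¬sameClass : ∀ {a x} → Avoids a → R (x %ℕ n) → ¬ SameClass n π a x
    avoids-¬sameClass {a} {x} avoids x∈R (k , ℓ , eq) = avoids k (subst R (sym σᵏa≡x) x∈R)
      where σᵏa≡x : iter σ k a %ℕ n ≡ x %ℕ n
            σᵏa≡x = trans (cong (_%ℕ n) (trans (sym (avoids-iter avoids k)) eq)) ([x+ℓn]%ℕn≡x%ℕn x ℓ)

    module _ (τ-involutive : ∀ x → τ (τ x) ≡ x) where

      π-reaches-τ : ∀ {z} → OnFiniteCycle σ z → R (z %ℕ n) → MeetsROnlyInResidueOf z →
                    ∃ λ t → iter π (suc t) z ≡ τ z
      π-reaches-τ {z} (p , cycle) z∈R only =
        let t , hit , not-before = minimal-witness (λ t → R? (iter σ (suc t) z %ℕ n)) {p}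
                                     (subst (R ∘ (_%ℕ n)) (sym cycle) z∈R)
        in t , (begin
          π (iter π t z)        ≡⟨ cong π (iter-π≡iter-σ t not-before) ⟩
          π (iter σ t z)        ≡⟨ sym (τ-involutive _) ⟩
          τ (iter σ (suc t) z)  ≡⟨ cong τ (onFiniteCycle-%ℕ-injective (suc t) (p , cycle) (only (suc t) hit)) ⟩
          τ z                   ∎)
        where open ≡-Reasoning

      τ-closes-cycle : ∀ {x} → OnFiniteCycle σ x → OnFiniteCycle σ (τ x) → R (x %ℕ n) →
                       MeetsROnlyInResidueOf x → MeetsROnlyInResidueOf (τ x) → OnFiniteCycle π x
      τ-closes-cycle {x} x-cycle τx-cycle x∈R x-only τx-only =
        let t , there = π-reaches-τ x-cycle x∈R x-only
            u , back  = π-reaches-τ τx-cycle (τ-preserves x x∈R) τx-only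
        in u ℕ.+ suc t , (begin
          iter π (suc u ℕ.+ suc t) x         ≡⟨ iter-+ π (suc u) (suc t) x ⟩
          iter π (suc u) (iter π (suc t) x)  ≡⟨ cong (iter π (suc u)) there ⟩
          iter π (suc u) (τ x)               ≡⟨ back ⟩
          τ (τ x)                            ≡⟨ τ-involutive x ⟩
          x                                  ∎)
        where open ≡-Reasoning

    module Representatives {m} {a : Fin (suc m) → ℤ} (a-cycles : ∀ p → OnFiniteCycle σ (a p))
             (a-distinct : ∀ p q → SameClass n σ (a p) (a q) → p ≡ q) where

      Meets : (ℕ → Set) → Fin (suc m) → Set
      Meets S p = ∃ λ k → S (iter σ k (a p) %ℕ n)

      meets? : ∀ {S : ℕ → Set} → (∀ r → Dec (S r)) → ∀ p → Dec (Meets S p)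
      meets? S? p = orbit-any? (λ x → S? (x %ℕ n)) (a-cycles p)

      shared-residue⇒≡ : ∀ {p q} k k' → iter σ k (a p) %ℕ n ≡ iter σ k' (a q) %ℕ n → p ≡ q
      shared-residue⇒≡ k k' same = a-distinct _ _ (sameClass-of-%ℕ k k' (a-cycles _) same)

      representative-meetsROnlyInResidueOf : ∀ {p y} k → y %ℕ n ≡ iter σ k (a p) %ℕ n →
        (∀ s → R (iter σ s (a p) %ℕ n) → iter σ s (a p) %ℕ n ≡ y %ℕ n) → MeetsROnlyInResidueOf y
      representative-meetsROnlyInResidueOf {p} {y} k same only s hit = trans σˢy≡ (only (s ℕ.+ k) (subst R σˢy≡ hit))
        where σˢy≡ : iter σ s y %ℕ n ≡ iter σ (s ℕ.+ k) (a p) %ℕ n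
              σˢy≡ = trans (iter-%ℕ-cong s same) (cong (_%ℕ n) (sym (iter-+ σ s k (a p))))

      fewerClasses-dropping : ∀ d → (∀ p → p ≢ d → Avoids (a p)) → AtLeastClasses n π m
      fewerClasses-dropping d avoid = AtLeastClasses-drop a d
        (λ p p≢d → avoids-onFiniteCycle (avoid p p≢d) (a-cycles p))
        (λ p q p≢d _ same → a-distinct p q (avoids-sameClass {b = a q} (avoid p p≢d) same))

      fewerClasses-if-one-meets-R : (∀ p q → Meets R p → Meets R q → p ≡ q) → AtLeastClasses n π m
      fewerClasses-if-one-meets-R unique with any? (meets? R?)
      ... | yes (d , d-meets) = fewerClasses-dropping d (λ p p≢d k hit → p≢d (unique p d (k , hit) d-meets))
      ... | no none           = fewerClasses-dropping Fin.zero (λ p _ k hit → none (p , k , hit))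

      fewerClasses-merging : ∀ {x} keep drop → OnFiniteCycle π x → R (x %ℕ n) →
                             (∀ p → p ≢ keep → p ≢ drop → Avoids (a p)) → AtLeastClasses n π m
      fewerClasses-merging {x} keep drop x-cycle x∈R avoid = AtLeastClasses-drop b drop b-cycles b-distinct
        where
        b : Fin (suc m) → ℤ
        b p with p Finₚ.≟ keep
        ... | yes _ = x
        ... | no _  = a p
        b-cycles : ∀ p → p ≢ drop → OnFiniteCycle π (b p)
        b-cycles p p≢drop with p Finₚ.≟ keep
        ... | yes _       = x-cycle
        ... | no p≢keep   = avoids-onFiniteCycle (avoid p p≢keep p≢drop) (a-cycles p)
        b-distinct : ∀ p q → p ≢ drop → q ≢ drop → SameClass n π (b p) (b q) → p ≡ q
        b-distinct p q p≢drop q≢drop same with p Finₚ.≟ keep | q Finₚ.≟ keep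
        ... | yes p≡keep | yes q≡keep = trans p≡keep (sym q≡keep)
        ... | yes _      | no q≢keep  = ⊥-elim (avoids-¬sameClass {x = x} (avoid q q≢keep q≢drop) x∈R
                                          (PeriodicMap.SameClass-sym {π} π-periodic {b = a q} x-cycle same))
        ... | no p≢keep  | yes _      = ⊥-elim (avoids-¬sameClass {x = x} (avoid p p≢keep p≢drop) x∈R same)
        ... | no p≢keep  | no _       = a-distinct p q (avoids-sameClass {b = a q} (avoid p p≢keep p≢drop) same)

  private
    periodic-at : ∀ {ρ : ℤ → ℤ} x d → ρ x ≡ x + d → ρ (x + + n) ≡ (x + + n) + d → ρ (x + + n) ≡ ρ x + + n
    periodic-at x d ρx ρx+n = trans ρx+n (trans (exchange x (+ n) d) (cong (_+ + n) (sym ρx)))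
      where exchange : ∀ x m d → (x + m) + d ≡ (x + d) + m
            exchange = solve-∀

  module ClassShift {ρ : ℤ → ℤ} {c : ℕ} (ℓ : ℤ)
           (on : ∀ x → x %ℕ n ≡ c → ρ x ≡ x + ℓ * + n) (off : ∀ x → x %ℕ n ≢ c → ρ x ≡ x) where

    classShift-periodic : Periodic ρ
    classShift-periodic x with x %ℕ n ℕ.≟ c
    ... | yes x≡c = periodic-at {ρ} x (ℓ * + n) (on x x≡c) (on (x + + n) (trans ([x+n]%ℕn≡x%ℕn x) x≡c))
    ... | no x≢c  = trans (off (x + + n) (x≢c ∘ trans (sym ([x+n]%ℕn≡x%ℕn x)))) (cong (_+ + n) (sym (off x x≢c)))

    classShift-%ℕ : ∀ x → ρ x %ℕ n ≡ x %ℕ n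
    classShift-%ℕ x with x %ℕ n ℕ.≟ c
    ... | yes x≡c = trans (cong (_%ℕ n) (on x x≡c)) ([x+ℓn]%ℕn≡x%ℕn x ℓ)
    ... | no x≢c  = cong (_%ℕ n) (off x x≢c)

  module ClassSwap {ρ : ℤ → ℤ} {i j : ℤ}
           (on-i : ∀ x → x %ℕ n ≡ i %ℕ n → ρ x ≡ x + (j - i))
           (on-j : ∀ x → x %ℕ n ≡ j %ℕ n → ρ x ≡ x + (i - j))
           (off : ∀ x → x %ℕ n ≢ i %ℕ n → x %ℕ n ≢ j %ℕ n → ρ x ≡ x) where

    private
      there-and-back : ∀ x i j → (x + (j - i)) + (i - j) ≡ x
      there-and-back = solve-∀

    classSwap-i→j : ∀ x → x %ℕ n ≡ i %ℕ n → ρ x %ℕ n ≡ j %ℕ n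
    classSwap-i→j x x≡i = trans (cong (_%ℕ n) (on-i x x≡i)) (%ℕ-+-difference x i j x≡i)

    classSwap-j→i : ∀ x → x %ℕ n ≡ j %ℕ n → ρ x %ℕ n ≡ i %ℕ n
    classSwap-j→i x x≡j = trans (cong (_%ℕ n) (on-j x x≡j)) (%ℕ-+-difference x j i x≡j)

    classSwap-involutive : ∀ x → ρ (ρ x) ≡ x
    classSwap-involutive x with x %ℕ n ℕ.≟ i %ℕ n | x %ℕ n ℕ.≟ j %ℕ n
    ... | yes x≡i | _ =
      trans (on-j (ρ x) (classSwap-i→j x x≡i)) (trans (cong (_+ (i - j)) (on-i x x≡i)) (there-and-back x i j))
    ... | no _ | yes x≡j =
      trans (on-i (ρ x) (classSwap-j→i x x≡j)) (trans (cong (_+ (j - i)) (on-j x x≡j)) (there-and-back x j i))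
    ... | no x≢i | no x≢j = trans (cong ρ (off x x≢i x≢j)) (off x x≢i x≢j)

    classSwap-periodic : Periodic ρ
    classSwap-periodic x with x %ℕ n ℕ.≟ i %ℕ n | x %ℕ n ℕ.≟ j %ℕ n
    ... | yes x≡i | _ = periodic-at {ρ} x (j - i) (on-i x x≡i) (on-i (x + + n) (trans ([x+n]%ℕn≡x%ℕn x) x≡i))
    ... | no _ | yes x≡j = periodic-at {ρ} x (i - j) (on-j x x≡j) (on-j (x + + n) (trans ([x+n]%ℕn≡x%ℕn x) x≡j))
    ... | no x≢i | no x≢j = trans (off (x + + n) (x≢i ∘ trans (sym ([x+n]%ℕn≡x%ℕn x))) (x≢j ∘ trans (sym ([x+n]%ℕn≡x%ℕn x))))
                                  (cong (_+ + n) (sym (off x x≢i x≢j)))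

  module _ (i : ℕ) where

    shift-on : ∀ x → x %ℕ n ≡ i ℕ.% n → shift n i x ≡ x + 1ℤ * + n
    shift-on x x≡i with x %ℕ n ℕ.≟ i ℕ.% n
    ... | yes _   = cong (_+_ x) (sym (*-identityˡ (+ n)))
    ... | no x≢i  = ⊥-elim (x≢i x≡i)

    shift-off : ∀ x → x %ℕ n ≢ i ℕ.% n → shift n i x ≡ x
    shift-off x x≢i with x %ℕ n ℕ.≟ i ℕ.% n
    ... | yes x≡i = ⊥-elim (x≢i x≡i)
    ... | no _    = refl

    unshift-on : ∀ x → x %ℕ n ≡ i ℕ.% n → unshift n i x ≡ x + (- 1ℤ) * + n
    unshift-on x x≡i with x %ℕ n ℕ.≟ i ℕ.% n
    ... | yes _   = minus x (+ n)
      where minus : ∀ x m → x - m ≡ x + (- 1ℤ) * m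
            minus = solve-∀
    ... | no x≢i  = ⊥-elim (x≢i x≡i)

    unshift-off : ∀ x → x %ℕ n ≢ i ℕ.% n → unshift n i x ≡ x
    unshift-off x x≢i with x %ℕ n ℕ.≟ i ℕ.% n
    ... | yes x≡i = ⊥-elim (x≢i x≡i)
    ... | no _    = refl

  module _ (i j : ℤ) where

    refl-perm-i : ∀ x → x %ℕ n ≡ i %ℕ n → refl-perm n i j x ≡ x + (j - i)
    refl-perm-i x x≡i with x %ℕ n ℕ.≟ i %ℕ n | x %ℕ n ℕ.≟ j %ℕ n
    ... | yes _   | _ = refl
    ... | no x≢i  | _ = ⊥-elim (x≢i x≡i)

    refl-perm-j : i %ℕ n ≢ j %ℕ n → ∀ x → x %ℕ n ≡ j %ℕ n → refl-perm n i j x ≡ x + (i - j)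
    refl-perm-j i≢j x x≡j with x %ℕ n ℕ.≟ i %ℕ n | x %ℕ n ℕ.≟ j %ℕ n
    ... | yes x≡i | _       = ⊥-elim (i≢j (trans (sym x≡i) x≡j))
    ... | no _    | yes _   = refl
    ... | no _    | no x≢j  = ⊥-elim (x≢j x≡j)

    refl-perm-off : ∀ x → x %ℕ n ≢ i %ℕ n → x %ℕ n ≢ j %ℕ n → refl-perm n i j x ≡ x
    refl-perm-off x x≢i x≢j with x %ℕ n ℕ.≟ i %ℕ n | x %ℕ n ℕ.≟ j %ℕ n
    ... | yes x≡i | _       = ⊥-elim (x≢i x≡i)
    ... | no _    | yes x≡j = ⊥-elim (x≢j x≡j)
    ... | no _    | no _    = refl

  module _ {π : ℤ → ℤ} (π-periodic : Periodic π) where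

    module _ {τ : ℤ → ℤ} (τ-periodic : Periodic τ) where

      fewerClasses-oneResidue : ∀ c → (∀ x → x %ℕ n ≢ c → τ x ≡ x) → (∀ x → x %ℕ n ≡ c → τ x %ℕ n ≡ c) →
        ∀ m → AtLeastClasses n (τ ∘ π) (suc m) → AtLeastClasses n π m
      fewerClasses-oneResidue c fixes preserves m (a , cycles , distinct) =
        fewerClasses-if-one-meets-R (λ _ _ (k , hit) (k' , hit') → shared-residue⇒≡ k k' (trans hit (sym hit')))
        where
        open Reduction {π} {τ} π-periodic τ-periodic (ℕ._≟ c) fixes preserves
        open Representatives cycles distinct

      module _ (ri rj : ℕ) (involutive : ∀ x → τ (τ x) ≡ x)
               (fixes : ∀ x → x %ℕ n ≢ ri → x %ℕ n ≢ rj → τ x ≡ x)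
               (i→j : ∀ x → x %ℕ n ≡ ri → τ x %ℕ n ≡ rj) (j→i : ∀ x → x %ℕ n ≡ rj → τ x %ℕ n ≡ ri) where

        private
          R : ℕ → Set
          R r = r ≡ ri ⊎ r ≡ rj

        open Reduction {π} {τ} π-periodic τ-periodic {R} (λ r → (r ℕ.≟ ri) ⊎-dec (r ℕ.≟ rj))
          (λ x x∉R → fixes x (x∉R ∘ inj₁) (x∉R ∘ inj₂)) (λ x → [ inj₂ ∘ i→j x , inj₁ ∘ j→i x ]′)

        module _ {m} {a : Fin (suc m) → ℤ} (cycles : ∀ p → OnFiniteCycle σ (a p))
                 (distinct : ∀ p q → SameClass n σ (a p) (a q) → p ≡ q) where

          open Representatives cycles distinct

          MergeablePair : Set
          MergeablePair = ∃ λ pᵢ → ∃ λ pⱼ → Meets (_≡ ri) pᵢ × Meets (_≡ rj) pⱼ × pᵢ ≢ pⱼ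

          fewerClasses-merging-pair : MergeablePair → AtLeastClasses n π m
          fewerClasses-merging-pair (pᵢ , pⱼ , (k₁ , x≡ri) , (k₂ , w≡rj) , pᵢ≢pⱼ) =
            fewerClasses-merging pᵢ pⱼ x-cycle (inj₁ x≡ri) avoid
            where
            x : ℤ
            x = iter σ k₁ (a pᵢ)
            τx≡w : τ x %ℕ n ≡ iter σ k₂ (a pⱼ) %ℕ n
            τx≡w = trans (i→j x x≡ri) (sym w≡rj)
            pᵢ-only : ∀ s → R (iter σ s (a pᵢ) %ℕ n) → iter σ s (a pᵢ) %ℕ n ≡ x %ℕ n
            pᵢ-only s (inj₁ hit) = trans hit (sym x≡ri)
            pᵢ-only s (inj₂ hit) = ⊥-elim (pᵢ≢pⱼ (shared-residue⇒≡ s k₂ (trans hit (sym w≡rj))))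
            pⱼ-only : ∀ s → R (iter σ s (a pⱼ) %ℕ n) → iter σ s (a pⱼ) %ℕ n ≡ τ x %ℕ n
            pⱼ-only s (inj₁ hit) = ⊥-elim (pᵢ≢pⱼ (shared-residue⇒≡ k₁ s (trans x≡ri (sym hit))))
            pⱼ-only s (inj₂ hit) = trans hit (sym (i→j x x≡ri))
            x-cycle : OnFiniteCycle π x
            x-cycle = τ-closes-cycle involutive (onFiniteCycle-iter k₁ (cycles pᵢ))
              (onFiniteCycle-%ℕ-cong τx≡w (onFiniteCycle-iter k₂ (cycles pⱼ))) (inj₁ x≡ri)
              (representative-meetsROnlyInResidueOf k₁ refl pᵢ-only) (representative-meetsROnlyInResidueOf k₂ τx≡w pⱼ-only)
            avoid : ∀ p → p ≢ pᵢ → p ≢ pⱼ → Avoids (a p)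
            avoid p p≢pᵢ _ s (inj₁ hit) = p≢pᵢ (shared-residue⇒≡ s k₁ (trans hit (sym x≡ri)))
            avoid p _ p≢pⱼ s (inj₂ hit) = p≢pⱼ (shared-residue⇒≡ s k₂ (trans hit (sym w≡rj)))

          unique-meeting-R : ¬ MergeablePair → ∀ p q → Meets R p → Meets R q → p ≡ q
          unique-meeting-R _ p q (k , inj₁ hit) (k' , inj₁ hit') = shared-residue⇒≡ k k' (trans hit (sym hit'))
          unique-meeting-R _ p q (k , inj₂ hit) (k' , inj₂ hit') = shared-residue⇒≡ k k' (trans hit (sym hit'))
          unique-meeting-R none p q (k , inj₁ hit) (k' , inj₂ hit') =
            decidable-stable (p Finₚ.≟ q) (λ p≢q → none (p , q , (k , hit) , (k' , hit') , p≢q))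
          unique-meeting-R none p q (k , inj₂ hit) (k' , inj₁ hit') =
            sym (unique-meeting-R none q p (k' , inj₁ hit') (k , inj₂ hit))

          mergeablePair? : Dec MergeablePair
          mergeablePair? = any? λ pᵢ → any? λ pⱼ →
            meets? (ℕ._≟ ri) pᵢ ×-dec meets? (ℕ._≟ rj) pⱼ ×-dec ¬? (pᵢ Finₚ.≟ pⱼ)

          fewerClasses-swapping : AtLeastClasses n π m
          fewerClasses-swapping with mergeablePair?
          ... | yes pair = fewerClasses-merging-pair pair
          ... | no none  = fewerClasses-if-one-meets-R (unique-meeting-R none)

        fewerClasses-swap : ∀ m → AtLeastClasses n (τ ∘ π) (suc m) → AtLeastClasses n π m
        fewerClasses-swap m (a , cycles , distinct) = fewerClasses-swapping cycles distinct

    fewerClasses-shift : ∀ i m → AtLeastClasses n (shift n i ∘ π) (suc m) → AtLeastClasses n π m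
    fewerClasses-shift i = fewerClasses-oneResidue classShift-periodic (i ℕ.% n) (shift-off i)
                             (λ x x≡i → trans (classShift-%ℕ x) x≡i)
      where open ClassShift {shift n i} {i ℕ.% n} 1ℤ (shift-on i) (shift-off i)

    fewerClasses-unshift : ∀ i m → AtLeastClasses n (unshift n i ∘ π) (suc m) → AtLeastClasses n π m
    fewerClasses-unshift i = fewerClasses-oneResidue classShift-periodic (i ℕ.% n) (unshift-off i)
                               (λ x x≡i → trans (classShift-%ℕ x) x≡i)
      where open ClassShift {unshift n i} {i ℕ.% n} (- 1ℤ) (unshift-on i) (unshift-off i)

    fewerClasses-reflection : ∀ i j → i %ℕ n ≢ j %ℕ n →
      ∀ m → AtLeastClasses n (refl-perm n i j ∘ π) (suc m) → AtLeastClasses n π m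
    fewerClasses-reflection i j i≢j =
      fewerClasses-swap classSwap-periodic (i %ℕ n) (j %ℕ n) classSwap-involutive (refl-perm-off i j)
        classSwap-i→j classSwap-j→i
      where open ClassSwap {refl-perm n i j} {i} {j} (refl-perm-i i j) (refl-perm-j i j i≢j) (refl-perm-off i j)

lemma3p27 : (n : ℕ) → .{{_ : NonZero n}} → 2 ≤ n →
    (π : ℤ → ℤ) → PeriodicPerm n π →
    (τ : ℤ → ℤ) → InTL n τ →
    (m : ℕ) → AtLeastClasses n (τ ∘ π) (suc m) → AtLeastClasses n π m
lemma3p27 n _ π (_ , π-periodic) τ (inj₁ (i , j , i≢j , τ≗ρ)) m =
  fewerClasses-reflection n {π} π-periodic i j i≢j m ∘ AtLeastClasses-cong n (τ≗ρ ∘ π)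
lemma3p27 n _ π (_ , π-periodic) τ (inj₂ (i , _ , _ , inj₁ τ≗ℓᵢ)) m =
  fewerClasses-shift n {π} π-periodic i m ∘ AtLeastClasses-cong n (τ≗ℓᵢ ∘ π)
lemma3p27 n _ π (_ , π-periodic) τ (inj₂ (i , _ , _ , inj₂ τ≗ℓᵢ⁻¹)) m =
  fewerClasses-unshift n {π} π-periodic i m ∘ AtLeastClasses-cong n (τ≗ℓᵢ⁻¹ ∘ π)
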